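{- Let $B$ be a lower Eulerian poset with a weak rank function $r_B$. If $\kappa_B\in\mathcal{I}(B)\cap U(B)$ is multiplicative and rank alternating, then $\kappa_B$ is a $B$-kernel, i.e. $\kappa_B^{ -1}=\kappa_B^{\mathrm{rev}}$.
   Context: $B$ is finite. $I(B)$ is the set of functions $p$ from closed intervals $[z,z']$ of $B$ to $\mathbb{Z}[t]$, a ring under pointwise sum and product $(p\cdot p')(z,z')=\sum_{z\le z''\le z'}p(z,z'')p'(z'',z')$, with unit $\delta_B$ ($1$ on $[z,z]$, $0$ otherwise). A weak rank function is $r_B\in I(B)$ with nonnegative integer values, positive for $z<z'$, with $r_B(z,z')=r_B(z,z'')+r_B(z'',z')$. $\mathcal{I}(B)=\{p:\deg p(z,z')\le r_B(z,z')\}$, with $p^{\mathrm{rev}}(z,z';t)=t^{r_B(z,z')}p(z,z';t^{ -1})$; $U(B)=\{p:p(z,z)=1\}$. A $B$-kernel is $\kappa\in\mathcal{I}(B)\cap U(B)$ with $\kappa^{ -1}=\kappa^{\mathrm{rev}}$. $B$ lower Eulerian: unique minimal element, rank function $\rho_B$ ($\rho_B(z')=\rho_B(z)+1$ when $z'$ covers $z$), and $\sum_{z\le z''\le z'}(-1)^{\rho_B(z'')}=0$ for $z<z'$; $\rho_B(z,z')=\rho_B(z')-\rho_B(z)$. $p$ is rank alternating if $p^{\mathrm{rev}}(z,z')=(-1)^{\rho_B(z,z')}p(z,z')$ for all $z\le z'$, and multiplicative if $p(z,z')=p(z,z'')p(z'',z')$ for all $z\le z''\le z'$. -}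

module Defs where

open import Data.Nat as ℕ using (ℕ; zero; suc; _∸_)
open import Data.Integer as ℤ using (ℤ; +_; -_; ∣_∣)
open import Data.Fin using (Fin)
open import Data.List using (List; []; _∷_; filter; map; upTo; allFin)
import Data.List as L
open import Data.Bool using (if_then_else_)
open import Data.Product using (_×_; _,_; Σ; ∃)
open import Relation.Nullary using (¬_; Dec; yes; no; does)
open import Relation.Nullary.Decidable using (_×-dec_)
open import Relation.Binary.PropositionalEquality using (_≡_)
open import Relation.Binary.Structures using (IsDecPartialOrder)

-- ℤ[t], represented by coefficient sequences  ℕ → ℤ  (coefficient of t^k).
-- All polynomials that occur below are of bounded degree.

Poly : Set
Poly = ℕ → ℤ

sumℤ : List ℤ → ℤ
sumℤ = L.foldr ℤ._+_ (+ 0)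

0ₚ 1ₚ : Poly
0ₚ k = + 0
1ₚ zero    = + 1
1ₚ (suc k) = + 0

_+ₚ_ : Poly → Poly → Poly
(p +ₚ q) k = p k ℤ.+ q k

_*ₚ_ : Poly → Poly → Poly
(p *ₚ q) k = sumℤ (map (λ i → p i ℤ.* q (k ∸ i)) (upTo (suc k)))

_·ₚ_ : ℤ → Poly → Poly
(c ·ₚ p) k = c ℤ.* p k

_≈ₚ_ : Poly → Poly → Set
p ≈ₚ q = ∀ k → p k ≡ q k

DegLe : Poly → ℕ → Set
DegLe p d = ∀ k → d ℕ.< k → p k ≡ + 0

-- t^d · p(t⁻¹)  (for deg p ≤ d): coefficient of t^k is p_{d-k} for k ≤ d, else 0
revₚ : ℕ → Poly → Poly
revₚ d p k = if does (k ℕ.≤? d) then p (d ∸ k) else + 0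

signℕ : ℕ → ℤ
signℕ zero    = + 1
signℕ (suc n) = - signℕ n

negOnePow : ℤ → ℤ
negOnePow m = signℕ ∣ m ∣

record FinPoset : Set₁ where
  field
    n          : ℕ
    _≤_        : Fin n → Fin n → Set
    isDecPO    : IsDecPartialOrder _≡_ _≤_

  Carrier : Set
  Carrier = Fin n

  open IsDecPartialOrder isDecPO public using (_≤?_)

  _<_ : Carrier → Carrier → Set
  z < z' = (z ≤ z') × ¬ (z ≡ z')

  _⋖_ : Carrier → Carrier → Set
  z ⋖ z' = (z < z') × (∀ w → z < w → ¬ (w < z'))

  interval : Carrier → Carrier → List Carrier
  interval z z' = filter (λ w → (z ≤? w) ×-dec (w ≤? z')) (allFin n)

  Σ[_,_] : Carrier → Carrier → (Carrier → ℤ) → ℤ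
  Σ[ z , z' ] f = sumℤ (map f (interval z z'))

  Minimal : Carrier → Set
  Minimal m = ∀ z → z ≤ m → z ≡ m

  -- Incidence algebra I(B) over ℤ[t]: functions on intervals.
  -- An element is a function B → B → ℤ[t]; only values on z ≤ z' matter.

  Inc : Set
  Inc = Carrier → Carrier → Poly

  _≈ᴵ_ : Inc → Inc → Set
  p ≈ᴵ q = ∀ z z' → z ≤ z' → p z z' ≈ₚ q z z'

  _·ᴵ_ : Inc → Inc → Inc
  (p ·ᴵ q) z z' k = Σ[ z , z' ] (λ w → (p z w *ₚ q w z') k)

  δ : Inc
  δ z z' = if does (z ≟ z') then 1ₚ else 0ₚ
    where open import Data.Fin using (_≟_)

  record WeakRank (r : Carrier → Carrier → ℕ) : Set where
    field
      pos   : ∀ z z' → z < z' → 0 ℕ.< r z z'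
      additive : ∀ z z'' z' → z ≤ z'' → z'' ≤ z' → r z z' ≡ r z z'' ℕ.+ r z'' z'

  IsRankFunction : (Carrier → ℕ) → Set
  IsRankFunction ρ = ∀ z z' → z ⋖ z' → ρ z' ≡ suc (ρ z)

  ρ[_,_,_] : (Carrier → ℕ) → Carrier → Carrier → ℤ
  ρ[ ρ , z , z' ] = + ρ z' ℤ.- + ρ z

  record LowerEulerian (ρ : Carrier → ℕ) : Set where
    field
      minimum         : Carrier
      minimum-minimal : Minimal minimum
      minimal-unique  : ∀ m → Minimal m → m ≡ minimum
      rank            : IsRankFunction ρ
      eulerian        : ∀ z z' → z < z' → Σ[ z , z' ] (λ w → signℕ (ρ w)) ≡ + 0

  module _ (r : Carrier → Carrier → ℕ) where

    InCalI : Inc → Set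
    InCalI p = ∀ z z' → z ≤ z' → DegLe (p z z') (r z z')

    rev : Inc → Inc
    rev p z z' = revₚ (r z z') (p z z')

  InU : Inc → Set
  InU p = ∀ z → p z z ≈ₚ 1ₚ

  Multiplicative : Inc → Set
  Multiplicative p = ∀ z z'' z' → z ≤ z'' → z'' ≤ z' → p z z' ≈ₚ (p z z'' *ₚ p z'' z')

  RankAlternating : (Carrier → Carrier → ℕ) → (Carrier → ℕ) → Inc → Set
  RankAlternating r ρ p = ∀ z z' → z ≤ z' → rev r p z z' ≈ₚ (negOnePow ρ[ ρ , z , z' ] ·ₚ p z z')

  IsInverse : Inc → Inc → Set
  IsInverse p q = ((p ·ᴵ q) ≈ᴵ δ) × ((q ·ᴵ p) ≈ᴵ δ)

  IsKernel : (Carrier → Carrier → ℕ) → Inc → Set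
  IsKernel r κ = InCalI r κ × InU κ × IsInverse κ (rev r κ)

{-# OPTIONS --safe #-}
module Submission where

-- For multiplicative, rank alternating κ and z ≤ w ≤ z', the summand
-- κ(z,w) κ^rev(w,z') equals (-1)^{ρ(z') - ρ(w)} κ(z,z'), so
--   (κ · κ^rev)(z,z') = (-1)^{ρ(z')} κ(z,z') Σ_{z ≤ w ≤ z'} (-1)^{ρ(w)},
-- which vanishes for z < z' because B is Eulerian and is κ(z,z)² = 1 for z = z';
-- the same computation applies to κ^rev · κ.

open import Defs
open import Data.Nat using (ℕ; zero; suc; _∸_)
open import Data.Integer as ℤ using (ℤ; +_; -_; ∣_∣; _⊖_)
open import Data.Integer.Properties
  using ( *-assoc; *-identityˡ; *-identityʳ; *-zeroʳ; *-distribˡ-+; *-commutativeSemigroup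
        ; neg-involutive; neg-distribˡ-*; neg-distribʳ-*; +-identityʳ
        ; [1+m]⊖[1+n]≡m⊖n; n⊖n≡0; m-n≡m⊖n)
open import Algebra.Properties.CommutativeSemigroup *-commutativeSemigroup
  using (x∙yz≈y∙xz; xy∙z≈y∙xz; xy∙z≈xz∙y; xy∙z≈yz∙x)
import Data.Fin as Fin
open import Data.List using ([]; _∷_; map; upTo; allFin)
open import Data.List.Properties using (map-cong; map-cong-local)
open import Data.List.Relation.Unary.All as All using (All; []; _∷_)
open import Data.List.Relation.Unary.All.Properties using (all-filter)
open import Data.List.Relation.Unary.AllPairs using (_∷_)
open import Data.List.Relation.Unary.Unique.Propositional using (Unique)
open import Data.List.Relation.Unary.Unique.Propositional.Properties
  using (filter⁺; allFin⁺)
open import Data.List.Membership.Propositional using (_∈_)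
open import Data.List.Membership.Propositional.Properties using (∈-filter⁺; ∈-allFin)
open import Data.Product using (_×_; _,_)
open import Data.Empty using (⊥-elim)
open import Relation.Nullary using (yes; no)
open import Relation.Nullary.Decidable using (_×-dec_)
open import Relation.Binary.PropositionalEquality
open import Relation.Binary.Structures using (IsDecPartialOrder)
open import Relation.Unary using (Decidable)

signℕ-⊖ : ∀ m n → signℕ ∣ m ⊖ n ∣ ≡ signℕ m ℤ.* signℕ n
signℕ-⊖ zero    zero    = refl
signℕ-⊖ (suc m) zero    = sym (*-identityʳ _)
signℕ-⊖ zero    (suc n) = sym (*-identityˡ _)
signℕ-⊖ (suc m) (suc n) = begin
  signℕ ∣ suc m ⊖ suc n ∣       ≡⟨ cong (λ i → signℕ ∣ i ∣) ([1+m]⊖[1+n]≡m⊖n m n) ⟩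
  signℕ ∣ m ⊖ n ∣               ≡⟨ signℕ-⊖ m n ⟩
  signℕ m ℤ.* signℕ n           ≡⟨ neg-involutive _ ⟨
  - - (signℕ m ℤ.* signℕ n)     ≡⟨ cong -_ (neg-distribˡ-* (signℕ m) (signℕ n)) ⟩
  - ((- signℕ m) ℤ.* signℕ n)   ≡⟨ neg-distribʳ-* (- signℕ m) (signℕ n) ⟩
  (- signℕ m) ℤ.* (- signℕ n)   ∎
  where open ≡-Reasoning

signℕ-square : ∀ n → signℕ n ℤ.* signℕ n ≡ + 1
signℕ-square n = trans (sym (signℕ-⊖ n n)) (cong (λ i → signℕ ∣ i ∣) (n⊖n≡0 n))

negOnePow-difference : ∀ m n → negOnePow (+ m ℤ.- + n) ≡ signℕ m ℤ.* signℕ n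
negOnePow-difference m n = trans (cong (λ i → signℕ ∣ i ∣) (m-n≡m⊖n m n)) (signℕ-⊖ m n)

module _ {A : Set} where

  sumℤ-map-*ˡ : ∀ (c : ℤ) (f : A → ℤ) xs →
                sumℤ (map (λ x → c ℤ.* f x) xs) ≡ c ℤ.* sumℤ (map f xs)
  sumℤ-map-*ˡ c f []       = sym (*-zeroʳ c)
  sumℤ-map-*ˡ c f (x ∷ xs) = trans (cong (ℤ._+_ (c ℤ.* f x)) (sumℤ-map-*ˡ c f xs))
                                   (sym (*-distribˡ-+ c (f x) (sumℤ (map f xs))))

  unique-constant⇒singleton : ∀ {z : A} {xs} → All (_≡ z) xs → Unique xs → z ∈ xs →
                              xs ≡ z ∷ []
  unique-constant⇒singleton {xs = x ∷ []}     (refl ∷ [])       _              _ = refl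
  unique-constant⇒singleton {xs = x ∷ y ∷ xs} (refl ∷ refl ∷ _) ((x≢y ∷ _) ∷ _) _ =
    ⊥-elim (x≢y refl)

*ₚ-congˡ : ∀ p {q q'} → q ≈ₚ q' → (p *ₚ q) ≈ₚ (p *ₚ q')
*ₚ-congˡ p q≈q' k = cong sumℤ (map-cong (λ i → cong (p i ℤ.*_) (q≈q' (k ∸ i))) (upTo (suc k)))

*ₚ-congʳ : ∀ {p p'} q → p ≈ₚ p' → (p *ₚ q) ≈ₚ (p' *ₚ q)
*ₚ-congʳ q p≈p' k = cong sumℤ (map-cong (λ i → cong (ℤ._* q (k ∸ i)) (p≈p' i)) (upTo (suc k)))

·ₚ-*ₚ-assoc : ∀ c p q → ((c ·ₚ p) *ₚ q) ≈ₚ (c ·ₚ (p *ₚ q))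
·ₚ-*ₚ-assoc c p q k = trans
  (cong sumℤ (map-cong (λ i → *-assoc c (p i) (q (k ∸ i))) (upTo (suc k))))
  (sumℤ-map-*ˡ c (λ i → p i ℤ.* q (k ∸ i)) (upTo (suc k)))

*ₚ-·ₚ-commute : ∀ c p q → (p *ₚ (c ·ₚ q)) ≈ₚ (c ·ₚ (p *ₚ q))
*ₚ-·ₚ-commute c p q k = trans
  (cong sumℤ (map-cong (λ i → x∙yz≈y∙xz (p i) c (q (k ∸ i))) (upTo (suc k))))
  (sumℤ-map-*ˡ c (λ i → p i ℤ.* q (k ∸ i)) (upTo (suc k)))

module _ (B : FinPoset) where
  open FinPoset B
  open IsDecPartialOrder isDecPO using (antisym) renaming (refl to ≤-refl)

  private
    between? : ∀ z z' → Decidable (λ w → z ≤ w × w ≤ z')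
    between? z z' w = (z ≤? w) ×-dec (w ≤? z')

  interval-bounds : ∀ z z' → All (λ w → z ≤ w × w ≤ z') (interval z z')
  interval-bounds z z' = all-filter (between? z z') (allFin n)

  interval-refl : ∀ z → interval z z ≡ z ∷ []
  interval-refl z = unique-constant⇒singleton
    (All.map (λ (z≤w , w≤z) → antisym w≤z z≤w) (interval-bounds z z))
    (filter⁺ (between? z z) (allFin⁺ n))
    (∈-filter⁺ (between? z z) (∈-allFin z) (≤-refl , ≤-refl))

  Σ-refl : ∀ z (f : Carrier → ℤ) → Σ[ z , z ] f ≡ f z
  Σ-refl z f = trans (cong (λ ws → sumℤ (map f ws)) (interval-refl z)) (+-identityʳ (f z))

  scaled-alternating-sum≡δ : ∀ {ρ} → LowerEulerian ρ → ∀ {z z'} → z ≤ z' → (c : ℤ) (k : ℕ) →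
    (z ≡ z' → c ℤ.* signℕ (ρ z) ≡ 1ₚ k) →
    Σ[ z , z' ] (λ w → c ℤ.* signℕ (ρ w)) ≡ δ z z' k
  scaled-alternating-sum≡δ {ρ} lowerEulerian {z} {z'} z≤z' c k diagonal with z Fin.≟ z'
  ... | yes refl = begin
    Σ[ z , z ] (λ w → c ℤ.* signℕ (ρ w))  ≡⟨ Σ-refl z (λ w → c ℤ.* signℕ (ρ w)) ⟩
    c ℤ.* signℕ (ρ z)                     ≡⟨ diagonal refl ⟩
    1ₚ k                                  ∎
    where open ≡-Reasoning
  ... | no z≢z' = begin
    Σ[ z , z' ] (λ w → c ℤ.* signℕ (ρ w))  ≡⟨ sumℤ-map-*ˡ c (λ w → signℕ (ρ w)) (interval z z') ⟩
    c ℤ.* Σ[ z , z' ] (λ w → signℕ (ρ w))  ≡⟨ cong (c ℤ.*_) (LowerEulerian.eulerian lowerEulerian z z' (z≤z' , z≢z')) ⟩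
    c ℤ.* + 0                              ≡⟨ *-zeroʳ c ⟩
    + 0                                    ∎
    where open ≡-Reasoning

  module _ (r : Carrier → Carrier → ℕ) {ρ : Carrier → ℕ} (lowerEulerian : LowerEulerian ρ)
           {κ : Inc} (κ∈U : InU κ) (multiplicative : Multiplicative κ)
           (alternating : RankAlternating r ρ κ) where

    private
      s : Carrier → ℤ
      s w = signℕ (ρ w)

    κ*rev≡signed-κ : ∀ {z w z'} → z ≤ w → w ≤ z' → ∀ k →
      (κ z w *ₚ rev r κ w z') k ≡ (s z' ℤ.* κ z z' k) ℤ.* s w
    κ*rev≡signed-κ {z} {w} {z'} z≤w w≤z' k = begin
      (κ z w *ₚ rev r κ w z') k                     ≡⟨ *ₚ-congˡ (κ z w) (alternating w z' w≤z') k ⟩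
      (κ z w *ₚ (negOnePow ρ[ ρ , w , z' ] ·ₚ κ w z')) k
        ≡⟨ *ₚ-·ₚ-commute (negOnePow ρ[ ρ , w , z' ]) (κ z w) (κ w z') k ⟩
      negOnePow ρ[ ρ , w , z' ] ℤ.* (κ z w *ₚ κ w z') k
        ≡⟨ cong₂ ℤ._*_ (negOnePow-difference (ρ z') (ρ w)) (sym (multiplicative z w z' z≤w w≤z' k)) ⟩
      (s z' ℤ.* s w) ℤ.* κ z z' k                   ≡⟨ xy∙z≈xz∙y (s z') (s w) (κ z z' k) ⟩
      (s z' ℤ.* κ z z' k) ℤ.* s w                   ∎
      where open ≡-Reasoning

    rev*κ≡signed-κ : ∀ {z w z'} → z ≤ w → w ≤ z' → ∀ k →
      (rev r κ z w *ₚ κ w z') k ≡ (s z ℤ.* κ z z' k) ℤ.* s w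
    rev*κ≡signed-κ {z} {w} {z'} z≤w w≤z' k = begin
      (rev r κ z w *ₚ κ w z') k                     ≡⟨ *ₚ-congʳ (κ w z') (alternating z w z≤w) k ⟩
      ((negOnePow ρ[ ρ , z , w ] ·ₚ κ z w) *ₚ κ w z') k
        ≡⟨ ·ₚ-*ₚ-assoc (negOnePow ρ[ ρ , z , w ]) (κ z w) (κ w z') k ⟩
      negOnePow ρ[ ρ , z , w ] ℤ.* (κ z w *ₚ κ w z') k
        ≡⟨ cong₂ ℤ._*_ (negOnePow-difference (ρ w) (ρ z)) (sym (multiplicative z w z' z≤w w≤z' k)) ⟩
      (s w ℤ.* s z) ℤ.* κ z z' k                    ≡⟨ xy∙z≈yz∙x (s w) (s z) (κ z z' k) ⟩
      (s z ℤ.* κ z z' k) ℤ.* s w                    ∎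
      where open ≡-Reasoning

    signed-κ-diagonal : ∀ z k → (s z ℤ.* κ z z k) ℤ.* s z ≡ 1ₚ k
    signed-κ-diagonal z k = begin
      (s z ℤ.* κ z z k) ℤ.* s z  ≡⟨ xy∙z≈y∙xz (s z) (κ z z k) (s z) ⟩
      κ z z k ℤ.* (s z ℤ.* s z)  ≡⟨ cong₂ ℤ._*_ (κ∈U z k) (signℕ-square (ρ z)) ⟩
      1ₚ k ℤ.* + 1               ≡⟨ *-identityʳ (1ₚ k) ⟩
      1ₚ k                       ∎
      where open ≡-Reasoning

    κ·rev≈δ : (κ ·ᴵ rev r κ) ≈ᴵ δ
    κ·rev≈δ z z' z≤z' k = begin
      Σ[ z , z' ] (λ w → (κ z w *ₚ rev r κ w z') k)
        ≡⟨ cong sumℤ (map-cong-local (All.map (λ (z≤w , w≤z') → κ*rev≡signed-κ z≤w w≤z' k)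
                                               (interval-bounds z z'))) ⟩
      Σ[ z , z' ] (λ w → (s z' ℤ.* κ z z' k) ℤ.* s w)
        ≡⟨ scaled-alternating-sum≡δ lowerEulerian z≤z' (s z' ℤ.* κ z z' k) k
             (λ { refl → signed-κ-diagonal z k }) ⟩
      δ z z' k  ∎
      where open ≡-Reasoning

    rev·κ≈δ : (rev r κ ·ᴵ κ) ≈ᴵ δ
    rev·κ≈δ z z' z≤z' k = begin
      Σ[ z , z' ] (λ w → (rev r κ z w *ₚ κ w z') k)
        ≡⟨ cong sumℤ (map-cong-local (All.map (λ (z≤w , w≤z') → rev*κ≡signed-κ z≤w w≤z' k)
                                               (interval-bounds z z'))) ⟩
      Σ[ z , z' ] (λ w → (s z ℤ.* κ z z' k) ℤ.* s w)
        ≡⟨ scaled-alternating-sum≡δ lowerEulerian z≤z' (s z ℤ.* κ z z' k) k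
             (λ { refl → signed-κ-diagonal z k }) ⟩
      δ z z' k  ∎
      where open ≡-Reasoning

lemma2p15 : (B : FinPoset) → let open FinPoset B in
    (r : Carrier → Carrier → ℕ) → WeakRank r →
    (ρ : Carrier → ℕ) → LowerEulerian ρ →
    (κ : Inc) → InCalI r κ → InU κ →
    Multiplicative κ → RankAlternating r ρ κ →
    IsKernel r κ
lemma2p15 B r _ ρ lowerEulerian κ κ∈𝓘 κ∈U multiplicative alternating =
  κ∈𝓘 , κ∈U , κ·rev≈δ B r lowerEulerian κ∈U multiplicative alternating
            , rev·κ≈δ B r lowerEulerian κ∈U multiplicative alternating
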